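{- A graph $G=(V,E)$ with at least one edge is uniformly dense if and only if $c(E\setminus A)-c(E)\le |A|/\rho(G)$ for all proper subsets $A\subset E$.
   Context: Graphs are finite and simple. $c(A)$ is the number of connected components of the graph $(V,A)$ and $\operatorname{rank}(A)=|V|-c(A)$; $\rho(A)=|A|/\operatorname{rank}(A)$ for nonempty $A$ and $\rho(G)=\rho(E)$. $G$ is uniformly dense if $\rho(A)\le\rho(E)$ for all nonempty $A\subseteq E$. -}

module Defs where

open import Data.Nat as ℕ using (ℕ; zero; suc; _<_)
open import Data.Bool using (Bool; true; false; _∧_; _∨_; if_then_else_)
open import Data.Fin using (Fin; toℕ; _≟_)
open import Data.Fin.Subset using (Subset; ⊤; ∁; ∣_∣; _∈_; inside; outside)
open import Data.Vec using (lookup)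
open import Data.Product using (_×_; _,_; proj₁; proj₂)
open import Data.List using (List; []; _∷_; filter; length)
open import Data.Bool.ListAction using (any)
open import Data.List using (allFin)
open import Data.Integer using (ℤ; +_; _-_)
open import Data.Rational as ℚ using (ℚ; 0ℚ; _*_; 1/_; ≢-nonZero)
import Data.Rational.Properties as ℚP
open import Relation.Nullary using (yes; no; does)
open import Function.Definitions using (Injective)
open import Relation.Binary.PropositionalEquality using (_≡_)

-- Edges are indexed by Fin m; edge e joins proj₁ (ends e) and proj₂ (ends e),
-- stored with the smaller endpoint first (so no loops), and distinct indices
-- give distinct edges (no multi-edges).
record Graph : Set where
  field
    n       : ℕ
    m       : ℕ
    ends    : Fin m → Fin n × Fin n
    ordered : ∀ e → toℕ (proj₁ (ends e)) < toℕ (proj₂ (ends e))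
    simple  : Injective _≡_ _≡_ ends

module _ (G : Graph) where
  open Graph G

  EdgeSet : Set
  EdgeSet = Subset m

  E : EdgeSet
  E = ⊤

  inA : EdgeSet → Fin m → Bool
  inA A e with lookup A e
  ... | inside  = true
  ... | outside = false

  adj : EdgeSet → Fin n → Fin n → Bool
  adj A u v = any (λ e → inA A e ∧ ((does (proj₁ (ends e) ≟ u) ∧ does (proj₂ (ends e) ≟ v))
                                   ∨ (does (proj₁ (ends e) ≟ v) ∧ does (proj₂ (ends e) ≟ u))))
                  (allFin m)

  walk : ℕ → EdgeSet → Fin n → Fin n → Bool
  walk zero    A u v = does (u ≟ v)
  walk (suc k) A u v = walk k A u v ∨ any (λ w → walk k A u w ∧ adj A w v) (allFin n)

  -- u and v are in the same connected component of (V, A)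
  -- (walks of length ≤ n suffice in a graph on n vertices).
  connected : EdgeSet → Fin n → Fin n → Bool
  connected A = walk n A

  -- c(A): the number of connected components of (V, A), counted as the number
  -- of vertices v that are the least vertex of their component.
  isLeast : EdgeSet → Fin n → Bool
  isLeast A v = Data.Bool.not (any (λ u → does (toℕ u ℕ.<? toℕ v) ∧ connected A u v) (allFin n))

  c : EdgeSet → ℕ
  c A = length (filter (λ v → Data.Bool.T? (isLeast A v)) (allFin n))

  rank : EdgeSet → ℕ
  rank A = n ℕ.∸ c A

  -- ρ(A) = |A| / rank(A)  (for nonempty A; rank A ≥ 1 then, as G has no loops;
  -- the value 0 in the impossible case rank A = 0 is a dummy).
  ρ : EdgeSet → ℚ
  ρ A with rank A
  ... | zero  = 0ℚ
  ... | suc r = (+ ∣ A ∣) ℚ./ suc r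

  ρG : ℚ
  ρG = ρ E

-- Division of rationals, p ÷ q; only ever used with q ≠ 0 (the value 0 when
-- q = 0 is a dummy convention).
_÷_ : ℚ → ℚ → ℚ
p ÷ q with q ℚP.≟ 0ℚ
... | yes _  = 0ℚ
... | no q≢0 = p * (1/_ q {{≢-nonZero q≢0}})

UniformlyDense : Graph → Set
UniformlyDense G = ∀ (A : EdgeSet G) → Data.Fin.Subset.Nonempty A → ρ G A ℚ.≤ ρG G

-- Write B = E ∖ A, which ranges over the nonempty edge sets as A ranges over the proper
-- subsets of E. Since rank = |V| − c, we have c(B) − c(E) = rank(E) − rank(B), and
-- |A| = |E| − |B|. Multiplying the claimed bound by ρ(G) = |E| / rank(E) > 0 it becomes
-- |E| − rank(B) ρ(G) ≤ |E| − |B|, i.e. ρ(B) ≤ ρ(G). The only graph-theoretic input is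
-- that a nonempty edge set has positive rank.
module Submission where

open import Defs
open import Data.Nat using (_≤_)
open import Data.Fin.Subset using (_⊂_; ∁; ∣_∣)
open import Data.Integer using (+_; _-_)
open import Data.Rational using (_/_)
open import Data.Rational using () renaming (_≤_ to _≤ℚ_)
open import Function.Bundles using (_⇔_)

open import Level using (0ℓ)
open import Data.Nat as ℕ using (ℕ; zero; suc; _<_; NonZero)
import Data.Nat.Properties as ℕP
open import Data.Integer as ℤ using (ℤ)
import Data.Integer.Properties as ℤP
open import Data.Integer.Tactic.RingSolver using (solve-∀)
open import Data.Rational as ℚ using (0ℚ; 1/_; Positive)
import Data.Rational.Properties as ℚP
open import Data.Rational.Unnormalised as ℚᵘ using (mkℚᵘ; *≤*)
import Data.Rational.Unnormalised.Properties as ℚᵘP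
open import Data.Bool using (Bool; T; T?; _∧_)
open import Data.Bool.Properties using (T-≡; T-∧; T-∨; T-not-≡)
open import Data.Bool.ListAction using (any)
open import Data.Fin as Fin using (Fin; toℕ)
open import Data.Fin.Properties using (nonZeroIndex)
open import Data.Fin.Subset using (Subset; Nonempty; _∈_; ⊤)
open import Data.Fin.Subset.Properties
  using (∈⊤; ∣⊤∣≡n; ∣∁p∣≡n∸∣p∣; ∣p∣≤n; x∉p⇒x∈∁p; x∈p⇒x∉∁p; ∪-∩-booleanAlgebra)
open import Algebra.Lattice.Properties.BooleanAlgebra using (¬-involutive)
open import Data.Vec using (lookup)
open import Data.Vec.Properties using ([]=⇒lookup)
open import Data.List using (allFin)
open import Data.List.Properties using (length-filter; filter-notAll; length-tabulate)
open import Data.List.Membership.Propositional using (lose)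
open import Data.List.Membership.Propositional.Properties using (∈-allFin)
open import Data.List.Relation.Unary.Any.Properties using (any⁺)
open import Data.Product using (∃; _×_; _,_; proj₁; proj₂)
open import Data.Sum using (inj₁; inj₂)
open import Function.Base using (_∘_; id)
open import Function.Bundles using (Equivalence; mk⇔)
open import Function.Properties.Equivalence using (⇔-setoid)
open Equivalence using (to; from)
open import Relation.Nullary using (¬_; Dec; does; yes; no; contradiction)
open import Relation.Nullary.Decidable using (dec-true)
open import Relation.Binary.PropositionalEquality
  using (_≡_; refl; sym; trans; cong; cong₂; subst; subst₂; module ≡-Reasoning)

toℚᵘ-/ : ∀ x k → ℚ.toℚᵘ (x / suc k) ℚᵘ.≃ mkℚᵘ x k
toℚᵘ-/ x k = ℚP.toℚᵘ-fromℚᵘ (mkℚᵘ x k)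

/-≤-/⇔ : ∀ x y k l → (x / suc k ≤ℚ y / suc l) ⇔ (x ℤ.* + suc l ℤ.≤ y ℤ.* + suc k)
/-≤-/⇔ x y k l = mk⇔
  (λ p → ℚᵘP.drop-*≤* (ℚᵘP.≤-respʳ-≃ (toℚᵘ-/ y l) (ℚᵘP.≤-respˡ-≃ (toℚᵘ-/ x k) (ℚP.toℚᵘ-mono-≤ p))))
  (λ h → ℚP.toℚᵘ-cancel-≤
    (ℚᵘP.≤-respʳ-≃ (ℚᵘP.≃-sym (toℚᵘ-/ y l)) (ℚᵘP.≤-respˡ-≃ (ℚᵘP.≃-sym (toℚᵘ-/ x k)) (*≤* h))))

/1-*-/ : ∀ x y k → (x / 1) ℚ.* (y / suc k) ≡ (x ℤ.* y) / suc k
/1-*-/ x y k = ℚP.toℚᵘ-injective (begin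
  ℚ.toℚᵘ ((x / 1) ℚ.* (y / suc k))        ≈⟨ ℚP.toℚᵘ-homo-* (x / 1) (y / suc k) ⟩
  ℚ.toℚᵘ (x / 1) ℚᵘ.* ℚ.toℚᵘ (y / suc k)  ≈⟨ ℚᵘP.*-cong (toℚᵘ-/ x 0) (toℚᵘ-/ y k) ⟩
  mkℚᵘ x 0 ℚᵘ.* mkℚᵘ y k                  ≈⟨ ℚᵘP.≃-reflexive (cong (mkℚᵘ (x ℤ.* y)) (ℕP.+-identityʳ k)) ⟩
  mkℚᵘ (x ℤ.* y) k                        ≈⟨ toℚᵘ-/ (x ℤ.* y) k ⟨
  ℚ.toℚᵘ ((x ℤ.* y) / suc k)              ∎)
  where open import Relation.Binary.Reasoning.Setoid ℚᵘP.≃-setoid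

≤-÷⇔*-≤ : ∀ p q r .{{_ : Positive r}} → (p ≤ℚ q ÷ r) ⇔ (p ℚ.* r ≤ℚ q)
≤-÷⇔*-≤ p q r with r ℚP.≟ 0ℚ
... | yes r≡0 = contradiction (sym r≡0) (ℚP.<⇒≢ (ℚP.positive⁻¹ r))
... | no r≢0 = mk⇔
  (λ h → subst (p ℚ.* r ≤ℚ_) q/r*r≡q (ℚP.*-monoʳ-≤-nonNeg r {{ℚP.pos⇒nonNeg r}} h))
  (λ h → ℚP.*-cancelʳ-≤-pos r (subst (p ℚ.* r ≤ℚ_) (sym q/r*r≡q) h))
  where
  instance
    r-nonZero : ℚ.NonZero r
    r-nonZero = ℚP.pos⇒nonZero r
  q/r*r≡q : q ℚ.* (1/ r) ℚ.* r ≡ q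
  q/r*r≡q = trans (ℚP.*-assoc q (1/ r) r) (trans (cong (q ℚ.*_) (ℚP.*-inverseˡ r)) (ℚP.*-identityʳ q))

+-cancelˡ-≤ : ∀ k {i j} → k ℤ.+ i ℤ.≤ k ℤ.+ j → i ℤ.≤ j
+-cancelˡ-≤ k {i} {j} h = subst₂ ℤ._≤_ (-k+[k+i]≡i k i) (-k+[k+i]≡i k j) (ℤP.+-monoʳ-≤ (ℤ.- k) h)
  where
  -k+[k+i]≡i : ∀ k i → ℤ.- k ℤ.+ (k ℤ.+ i) ≡ i
  -k+[k+i]≡i = solve-∀

≤⇔≤-of-+-≡ : ∀ {u v w t} → u ℤ.+ v ≡ w ℤ.+ t → (w ℤ.≤ u ⇔ v ℤ.≤ t)
≤⇔≤-of-+-≡ {u} {v} {w} {t} eq = mk⇔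
  (λ w≤u → +-cancelˡ-≤ u (subst (ℤ._≤ u ℤ.+ t) (sym eq) (ℤP.+-monoˡ-≤ t w≤u)))
  (λ v≤t → +-cancelˡ-≤ t (subst₂ ℤ._≤_ (ℤP.+-comm w t) (ℤP.+-comm u t)
                            (subst (ℤ._≤ u ℤ.+ t) eq (ℤP.+-monoʳ-≤ u v≤t))))

cross-multiplied-criterion : ∀ a b s cB cE r r' → a ℤ.+ b ≡ s → cB ℤ.+ r ≡ cE ℤ.+ r' →
  ((cB ℤ.- cE) ℤ.* s ℤ.≤ a ℤ.* r' ⇔ b ℤ.* r' ℤ.≤ s ℤ.* r)
cross-multiplied-criterion a b s cB cE r r' a+b≡s cB+r≡cE+r' = ≤⇔≤-of-+-≡ (begin
  a ℤ.* r' ℤ.+ b ℤ.* r'           ≡⟨ ℤP.*-distribʳ-+ r' a b ⟨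
  (a ℤ.+ b) ℤ.* r'                ≡⟨ cong (ℤ._* r') a+b≡s ⟩
  s ℤ.* r'                        ≡⟨ sr'≡s[cE+r'-cE] s r' cE ⟩
  s ℤ.* (cE ℤ.+ r' ℤ.- cE)        ≡⟨ cong (λ t → s ℤ.* (t ℤ.- cE)) cB+r≡cE+r' ⟨
  s ℤ.* (cB ℤ.+ r ℤ.- cE)         ≡⟨ s[cB+r-cE]≡[cB-cE]s+sr s cB cE r ⟩
  (cB ℤ.- cE) ℤ.* s ℤ.+ s ℤ.* r   ∎)
  where
  open ≡-Reasoning
  sr'≡s[cE+r'-cE] : ∀ s r' cE → s ℤ.* r' ≡ s ℤ.* (cE ℤ.+ r' ℤ.- cE)
  sr'≡s[cE+r'-cE] = solve-∀
  s[cB+r-cE]≡[cB-cE]s+sr : ∀ s cB cE r → s ℤ.* (cB ℤ.+ r ℤ.- cE) ≡ (cB ℤ.- cE) ℤ.* s ℤ.+ s ℤ.* r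
  s[cB+r-cE]≡[cB-cE]s+sr = solve-∀

density-criterion : ∀ a b s cB cE r r' → a ℕ.+ b ≡ suc s → cB ℕ.+ suc r ≡ cE ℕ.+ suc r' →
  (+ b / suc r ≤ℚ + suc s / suc r') ⇔ ((+ cB - + cE) / 1 ≤ℚ (+ a / 1) ÷ (+ suc s / suc r'))
density-criterion a b s cB cE r r' a+b≡s cB+r≡cE+r' = begin
  + b / suc r ≤ℚ S / suc r'               ≈⟨ /-≤-/⇔ (+ b) S r r' ⟩
  + b ℤ.* R' ℤ.≤ S ℤ.* R                  ≈⟨ cross-multiplied-criterion (+ a) (+ b) S (+ cB) (+ cE) R R'
                                                (cong +_ a+b≡s) (cong +_ cB+r≡cE+r') ⟨
  X ℤ.* S ℤ.≤ + a ℤ.* R'                  ≡⟨ cong (ℤ._≤ + a ℤ.* R') (ℤP.*-identityʳ (X ℤ.* S)) ⟨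
  X ℤ.* S ℤ.* + 1 ℤ.≤ + a ℤ.* R'          ≈⟨ /-≤-/⇔ (X ℤ.* S) (+ a) r' 0 ⟨
  (X ℤ.* S) / suc r' ≤ℚ + a / 1           ≡⟨ cong (_≤ℚ + a / 1) (/1-*-/ X S r') ⟨
  (X / 1) ℚ.* (S / suc r') ≤ℚ + a / 1     ≈⟨ ≤-÷⇔*-≤ (X / 1) (+ a / 1) (S / suc r') ⟨
  X / 1 ≤ℚ (+ a / 1) ÷ (S / suc r')       ∎
  where
  open import Relation.Binary.Reasoning.Setoid (⇔-setoid 0ℓ)
  S R R' X : ℤ
  S = + suc s
  R = + suc r
  R' = + suc r'
  X = + cB - + cE
  instance
    ρ-positive : Positive (S / suc r')
    ρ-positive = ℚP.normalize-pos (suc s) (suc r')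

∣p∣+∣∁p∣≡n : ∀ {n} (p : Subset n) → ∣ p ∣ ℕ.+ ∣ ∁ p ∣ ≡ n
∣p∣+∣∁p∣≡n p = trans (cong (∣ p ∣ ℕ.+_) (∣∁p∣≡n∸∣p∣ p)) (ℕP.m+[n∸m]≡n (∣p∣≤n p))

∁-involutive : ∀ {n} (p : Subset n) → ∁ (∁ p) ≡ p
∁-involutive {n} = ¬-involutive (∪-∩-booleanAlgebra n)

⊂⊤⇒∁-nonempty : ∀ {n} {p : Subset n} → p ⊂ ⊤ → Nonempty (∁ p)
⊂⊤⇒∁-nonempty (_ , x , _ , x∉p) = x , x∉p⇒x∈∁p x∉p

nonempty⇒∁⊂⊤ : ∀ {n} {p : Subset n} → Nonempty p → ∁ p ⊂ ⊤
nonempty⇒∁⊂⊤ (x , x∈p) = (λ _ → ∈⊤) , x , ∈⊤ , x∈p⇒x∉∁p x∈p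

T-does : ∀ {P : Set} (P? : Dec P) → P → T (does P?)
T-does P? p = from T-≡ (dec-true P? p)

T-any-allFin : ∀ {k} (p : Fin k → Bool) x → T (p x) → T (any p (allFin k))
T-any-allFin p x px = any⁺ p (lose (∈-allFin x) px)

module _ (G : Graph) where
  open Graph G

  walk-refl : ∀ k A u → T (walk G k A u u)
  walk-refl zero    A u = T-does (u Fin.≟ u) refl
  walk-refl (suc k) A u = from T-∨ (inj₁ (walk-refl k A u))

  walk-snoc : ∀ k A u w v → T (walk G k A u w) → T (adj G A w v) → T (walk G (suc k) A u v)
  walk-snoc k A u w v uw wv = from T-∨ (inj₂ (T-any-allFin _ w (from T-∧ (uw , wv))))

  T-inA : ∀ A e → e ∈ A → T (inA G A e)
  T-inA A e e∈A with lookup A e | []=⇒lookup e∈A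
  ... | _ | refl = _

  adj-ends : ∀ A e → e ∈ A → T (adj G A (proj₁ (ends e)) (proj₂ (ends e)))
  adj-ends A e e∈A = T-any-allFin _ e (from T-∧ (T-inA A e e∈A , from T-∨ (inj₁ ends-match)))
    where
    u v : Fin n
    u = proj₁ (ends e)
    v = proj₂ (ends e)
    ends-match : T (does (u Fin.≟ u) ∧ does (v Fin.≟ v))
    ends-match = from T-∧ (T-does (u Fin.≟ u) refl , T-does (v Fin.≟ v) refl)

  walk-ends : ∀ k .{{_ : NonZero k}} A e → e ∈ A → T (walk G k A (proj₁ (ends e)) (proj₂ (ends e)))
  walk-ends (suc k) A e e∈A = walk-snoc k A _ _ _ (walk-refl k A _) (adj-ends A e e∈A)

  connected-ends : ∀ A e → e ∈ A → T (connected G A (proj₁ (ends e)) (proj₂ (ends e)))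
  connected-ends A e = walk-ends n {{nonZeroIndex (proj₁ (ends e))}} A e

  ¬isLeast : ∀ A u v → toℕ u < toℕ v → T (connected G A u v) → ¬ T (isLeast G A v)
  ¬isLeast A u v u<v uv least =
    subst T (to T-not-≡ least) (T-any-allFin _ u (from T-∧ (T-does (toℕ u ℕ.<? toℕ v) u<v , uv)))

  c≤n : ∀ A → c G A ≤ n
  c≤n A = ℕP.≤-trans (length-filter (T? ∘ isLeast G A) (allFin n)) (ℕP.≤-reflexive (length-tabulate id))

  -- The larger end of an edge of A is not the least vertex of its component.
  c<n : ∀ A → Nonempty A → c G A < n
  c<n A (e , e∈A) = ℕP.<-≤-trans
    (filter-notAll (T? ∘ isLeast G A) (allFin n)
      (lose (∈-allFin v) (¬isLeast A u v (ordered e) (connected-ends A e e∈A))))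
    (ℕP.≤-reflexive (length-tabulate id))
    where
    u v : Fin n
    u = proj₁ (ends e)
    v = proj₂ (ends e)

  nonempty⇒rank≡suc : ∀ A → Nonempty A → ∃ λ r → rank G A ≡ suc r × c G A ℕ.+ suc r ≡ n
  nonempty⇒rank≡suc A ne = r , rank≡1+r , subst (λ k → c G A ℕ.+ k ≡ n) rank≡1+r (ℕP.m+[n∸m]≡n (c≤n A))
    where
    r : ℕ
    r = n ℕ.∸ suc (c G A)
    rank≡1+r : rank G A ≡ suc r
    rank≡1+r = ℕP.+-∸-assoc 1 (c<n A ne)

  ρ≡/rank : ∀ A r → rank G A ≡ suc r → ρ G A ≡ + ∣ A ∣ / suc r
  ρ≡/rank A r rank≡1+r rewrite rank≡1+r = refl

ComponentBound : (G : Graph) → EdgeSet G → Set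
ComponentBound G A = ((+ c G (∁ A) - + c G (E G)) / 1) ≤ℚ ((+ ∣ A ∣ / 1) ÷ ρG G)

ρ-∁≤ρG⇔ComponentBound : ∀ G → 1 ≤ Graph.m G → ∀ A → Nonempty (∁ A) →
  (ρ G (∁ A) ≤ℚ ρG G) ⇔ ComponentBound G A
ρ-∁≤ρG⇔ComponentBound G 1≤m A ∁A≢∅
  with nonempty⇒rank≡suc G (∁ A) ∁A≢∅ | nonempty⇒rank≡suc G (E G) (Fin.fromℕ< 1≤m , ∈⊤)
... | r , rankB≡1+r , cB+1+r≡n | r' , rankE≡1+r' , cE+1+r'≡n = begin
  ρ G (∁ A) ≤ℚ ρG G                            ≡⟨ cong₂ _≤ℚ_ (ρ≡/rank G (∁ A) r rankB≡1+r) ρG≡ ⟩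
  + ∣ ∁ A ∣ / suc r ≤ℚ + suc s / suc r'        ≈⟨ density-criterion ∣ A ∣ ∣ ∁ A ∣ s (c G (∁ A)) (c G (E G)) r r'
                                                    (trans (∣p∣+∣∁p∣≡n A) (sym 1+s≡m))
                                                    (trans cB+1+r≡n (sym cE+1+r'≡n)) ⟩
  X / 1 ≤ℚ (+ ∣ A ∣ / 1) ÷ (+ suc s / suc r')  ≡⟨ cong (λ q → X / 1 ≤ℚ (+ ∣ A ∣ / 1) ÷ q) ρG≡ ⟨
  ComponentBound G A                           ∎
  where
  open import Relation.Binary.Reasoning.Setoid (⇔-setoid 0ℓ)
  open Graph G using (m)
  X : ℤ
  X = + c G (∁ A) - + c G (E G)
  s : ℕ
  s = ℕ.pred m
  1+s≡m : suc s ≡ m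
  1+s≡m = ℕP.suc-pred m {{ℕ.>-nonZero 1≤m}}
  ρG≡ : ρG G ≡ + suc s / suc r'
  ρG≡ = trans (ρ≡/rank G (E G) r' rankE≡1+r') (cong (λ k → + k / suc r') (trans (∣⊤∣≡n m) (sym 1+s≡m)))

proposition3p12 : (G : Graph) → 1 ≤ Graph.m G →
    (UniformlyDense G ⇔
      (∀ (A : EdgeSet G) → A ⊂ E G →
        ((+ c G (∁ A) - + c G (E G)) / 1) ≤ℚ ((+ ∣ A ∣ / 1) ÷ ρG G)))
proposition3p12 G 1≤m = mk⇔
  (λ dense A A⊂E → let ∁A≢∅ = ⊂⊤⇒∁-nonempty A⊂E in to (criterion A ∁A≢∅) (dense (∁ A) ∁A≢∅))
  (λ bound B B≢∅ → subst (λ B → ρ G B ≤ℚ ρG G) (∁-involutive B)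
    (from (criterion (∁ B) (subst Nonempty (sym (∁-involutive B)) B≢∅)) (bound (∁ B) (nonempty⇒∁⊂⊤ B≢∅))))
  where
  criterion : ∀ A → Nonempty (∁ A) → (ρ G (∁ A) ≤ℚ ρG G) ⇔ ComponentBound G A
  criterion = ρ-∁≤ρG⇔ComponentBound G 1≤m
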